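{- For every integer $n \ge 6$, $\mathrm{eqdim}(J_{n,2}) = 3$.
   Context: For positive integers $n > k$, the Johnson graph $J_{n,k}$ has as vertices all $k$-element subsets of $\{1,\dots,n\}$, two such subsets $A,B$ being adjacent iff $|A \cap B| = k-1$. In a connected graph $G$, $d(u,v)$ is the shortest-path distance. A subset $S \subseteq V(G)$ is a distance-equalizer set of $G$ if for every two distinct vertices $u,v \in V(G)\setminus S$ there exists $x \in S$ with $d(u,x) = d(v,x)$. The equidistant dimension $\mathrm{eqdim}(G)$ is the minimum cardinality of a distance-equalizer set of $G$. -}

module Defs where

open import Data.Nat using (ℕ; zero; suc; _≤_; _≥_)
open import Data.Fin.Subset using (Subset; ∣_∣; _∩_)
open import Data.Product using (Σ; ∃; ∃-syntax; _×_; _,_; proj₁)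
open import Data.List using (List; length)
open import Data.List.Membership.Propositional using (_∈_; _∉_)
open import Data.List.Relation.Unary.Unique.Propositional using (Unique)
open import Relation.Binary.PropositionalEquality using (_≡_; _≢_)

module _ {V : Set} (Adj : V → V → Set) where

  data Walk : V → V → ℕ → Set where
    here : ∀ {u} → Walk u u zero
    step : ∀ {u w v k} → Adj u w → Walk w v k → Walk u v (suc k)

  Dist : V → V → ℕ → Set
  Dist u v k = Walk u v k × (∀ m → Walk u v m → k ≤ m)

  IsDistanceEqualizer : List V → Set
  IsDistanceEqualizer S =
    ∀ u v → u ∉ S → v ∉ S → u ≢ v →
      ∃[ x ] (x ∈ S × ∃[ k ] (Dist u x k × Dist v x k))

  EqDim≡ : ℕ → Set
  EqDim≡ d =
    (∃[ S ] (Unique S × IsDistanceEqualizer S × length S ≡ d))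
    × (∀ S → Unique S → IsDistanceEqualizer S → length S ≥ d)

-- The Johnson graph J_{n,k}: k-element subsets of an n-element set
-- (here Fin n), adjacent iff their intersection has k-1 elements.

JVertex : ℕ → ℕ → Set
JVertex n k = Σ (Subset n) (λ A → ∣ A ∣ ≡ k)

JAdj : (n k : ℕ) → JVertex n k → JVertex n k → Set
JAdj n k A B = suc ∣ proj₁ A ∩ proj₁ B ∣ ≡ k

-- In J(n,2) the distance between 2-sets A and B is 2 − |A ∩ B|, so S equalizes u and v
-- exactly when some x ∈ S shares equally many points with u and with v.
-- Three suffice: take the sides of a triangle c₀c₁c₂. A vertex that is not a side contains
-- at most one corner, and for two such vertices the side through both contained corners
-- (if they differ) or the side opposite the contained corner meets both equally often.
-- Two never suffice once n ≥ 6: for any vertices x, y some vertex u is disjoint from x ∪ y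
-- and some v is a common neighbour of x and y, so d(u, ·) = 2 and d(v, ·) = 1 on {x, y}.
module Submission where

open import Defs
open import Data.Nat using (ℕ; suc; _+_; _∸_; _≤_; _≥_; _>_; z≤n; s≤s)
open import Data.Nat.Properties
  using (≡-irrelevant; suc-injective; ≤-trans; ≤-antisym; ≤-reflexive; <⇒≱; +-suc; +-identityʳ;
         m≤m+n; m∸n≤m; n≤1+n; ∸-monoˡ-≤; ∸-monoʳ-≤)
open import Data.Fin using (Fin; zero; suc)
import Data.Fin.Properties as Fin
open import Data.Fin.Subset
  using (Subset; inside; outside; _∈_; _∉_; _⊆_; ∣_∣; _∩_; _∪_; ∁; ⁅_⁆; ⊤; Nonempty; Empty)
open import Data.Fin.Subset.Properties
  using (_∈?_; nonempty?; Empty-unique; ∣⊥∣≡0; ∈⊤; x∈⁅x⁆; x∈⁅y⁆⇒x≡y; ∣⁅x⁆∣≡1; ⊆-antisym;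
         p⊆q⇒∣p∣≤∣q∣; drop-∷-⊆; x∈∁p⇒x∉p; ∣∁p∣≡n∸∣p∣; ∩-comm; ∩-idem; ∩-identityˡ; ∩-distribˡ-∪;
         p∩q⊆p; p∩q⊆q; x∈p∩q⁺; x∈p∩q⁻; x∈p∪q⁺; x∈p∪q⁻)
open import Data.Vec using ([]; _∷_; here; there)
open import Data.List using (List; length; []; _∷_)
open import Data.List.Relation.Unary.Any using (here; there)
open import Data.List.Relation.Unary.All using ([]; _∷_)
open import Data.List.Relation.Unary.AllPairs using ([]; _∷_)
open import Data.List.Relation.Unary.Unique.Propositional using (Unique)
open import Data.List.Membership.Propositional using () renaming (_∈_ to _∈ᴸ_; _∉_ to _∉ᴸ_)
open import Data.Product using (∃₂; ∃-syntax; _×_; _,_; proj₁)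
open import Data.Sum using (_⊎_; inj₁; inj₂; [_,_]′)
open import Data.Empty using (⊥-elim)
open import Function using (_∘_; _⇔_; mk⇔; Equivalence)
open import Relation.Nullary using (¬_; yes; no; contradiction)
open import Relation.Binary.PropositionalEquality
  using (_≡_; _≢_; refl; sym; trans; cong; cong₂; subst; subst₂; module ≡-Reasoning)

private
  variable
    n k : ℕ
    p q : Subset n
    x y z : Fin n

module _ {V : Set} {Adj : V → V → Set} where

  Dist-functional : ∀ {u v k l} → Dist Adj u v k → Dist Adj u v l → k ≡ l
  Dist-functional (walk-k , k-minimal) (walk-l , l-minimal) =
    ≤-antisym (k-minimal _ walk-l) (l-minimal _ walk-k)

  IsDistanceEqualizer-⊆ : ∀ {S T} → (∀ {x} → x ∈ᴸ S → x ∈ᴸ T) →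
                          IsDistanceEqualizer Adj S → IsDistanceEqualizer Adj T
  IsDistanceEqualizer-⊆ S⊆T equalizer u v u∉T v∉T u≢v =
    let x , x∈S , equidistant = equalizer u v (u∉T ∘ S⊆T) (v∉T ∘ S⊆T) u≢v
    in x , S⊆T x∈S , equidistant

  -- IsDistanceEqualizer allows repetitions, so shorter lists are padded up to two entries.
  equalizer-length≥3 : V → (∀ x y → ¬ IsDistanceEqualizer Adj (x ∷ y ∷ [])) →
                       ∀ {S} → IsDistanceEqualizer Adj S → length S ≥ 3
  equalizer-length≥3 v no-pair {[]} equalizer =
    ⊥-elim (no-pair v v (IsDistanceEqualizer-⊆ (λ ()) equalizer))
  equalizer-length≥3 v no-pair {x ∷ []} equalizer =
    ⊥-elim (no-pair x x (IsDistanceEqualizer-⊆ (λ { (here x≡) → here x≡ }) equalizer))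
  equalizer-length≥3 v no-pair {x ∷ y ∷ []} equalizer = ⊥-elim (no-pair x y equalizer)
  equalizer-length≥3 v no-pair {_ ∷ _ ∷ _ ∷ _} _ = s≤s (s≤s (s≤s z≤n))

  module _ {δ : V → V → ℕ} (dist : ∀ u v → Dist Adj u v (δ u v)) where

    δ-self : ∀ u → δ u u ≡ 0
    δ-self u = Dist-functional (dist u u) (here , λ _ _ → z≤n)

    Isδ-Equalizer : List V → Set
    Isδ-Equalizer S = ∀ u v → u ∉ᴸ S → v ∉ᴸ S → u ≢ v → ∃[ x ] (x ∈ᴸ S × δ u x ≡ δ v x)

    IsDistanceEqualizer⇔Isδ-Equalizer : ∀ S → IsDistanceEqualizer Adj S ⇔ Isδ-Equalizer S
    IsDistanceEqualizer⇔Isδ-Equalizer S = mk⇔ to from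
      where
      to : IsDistanceEqualizer Adj S → Isδ-Equalizer S
      to equalizer u v u∉S v∉S u≢v =
        let x , x∈S , _ , u-x , v-x = equalizer u v u∉S v∉S u≢v
        in x , x∈S , trans (Dist-functional (dist u x) u-x) (Dist-functional v-x (dist v x))
      from : Isδ-Equalizer S → IsDistanceEqualizer Adj S
      from equalizer u v u∉S v∉S u≢v =
        let x , x∈S , δ-equal = equalizer u v u∉S v∉S u≢v
        in x , x∈S , δ u x , dist u x , subst (Dist Adj v x) (sym δ-equal) (dist v x)

    far-near⇒¬equalizer : ∀ {x y} u v → δ u x ≡ 2 → δ u y ≡ 2 → δ v x ≡ 1 → δ v y ≡ 1 →
                          ¬ IsDistanceEqualizer Adj (x ∷ y ∷ [])
    far-near⇒¬equalizer {x} {y} u v ux uy vx vy equalizer =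
      let _ , z∈ , δ-equal =
            Equivalence.to (IsDistanceEqualizer⇔Isδ-Equalizer _) equalizer u v u∉ v∉ u≢v
      in not-equidistant z∈ δ-equal
      where
      u∉ : u ∉ᴸ x ∷ y ∷ []
      u∉ (here refl) = contradiction (trans (sym (δ-self u)) ux) λ ()
      u∉ (there (here refl)) = contradiction (trans (sym (δ-self u)) uy) λ ()
      v∉ : v ∉ᴸ x ∷ y ∷ []
      v∉ (here refl) = contradiction (trans (sym (δ-self v)) vx) λ ()
      v∉ (there (here refl)) = contradiction (trans (sym (δ-self v)) vy) λ ()
      u≢v : u ≢ v
      u≢v refl = contradiction (trans (sym ux) vx) λ ()
      not-equidistant : ∀ {z} → z ∈ᴸ x ∷ y ∷ [] → δ u z ≢ δ v z
      not-equidistant (here refl) δ-equal = contradiction (trans (sym ux) (trans δ-equal vx)) λ ()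
      not-equidistant (there (here refl)) δ-equal =
        contradiction (trans (sym uy) (trans δ-equal vy)) λ ()

∣p∣>0⇒Nonempty : ∀ (p : Subset n) → ∣ p ∣ > 0 → Nonempty p
∣p∣>0⇒Nonempty (inside ∷ p) _ = zero , here
∣p∣>0⇒Nonempty (outside ∷ p) ∣p∣>0 =
  let x , x∈p = ∣p∣>0⇒Nonempty p ∣p∣>0 in suc x , there x∈p

two-elements : ∀ (p : Subset n) → ∣ p ∣ ≥ 2 → ∃₂ λ x y → x ≢ y × x ∈ p × y ∈ p
two-elements (inside ∷ p) (s≤s ∣p∣>0) =
  let y , y∈p = ∣p∣>0⇒Nonempty p ∣p∣>0 in zero , suc y , (λ ()) , here , there y∈p
two-elements (outside ∷ p) ∣p∣≥2 =
  let x , y , x≢y , x∈p , y∈p = two-elements p ∣p∣≥2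
  in suc x , suc y , x≢y ∘ Fin.suc-injective , there x∈p , there y∈p

x∈p⇒⁅x⁆⊆p : x ∈ p → ⁅ x ⁆ ⊆ p
x∈p⇒⁅x⁆⊆p {x = x} {p = p} x∈p y∈⁅x⁆ = subst (_∈ p) (sym (x∈⁅y⁆⇒x≡y x y∈⁅x⁆)) x∈p

Empty⇒∣p∣≡0 : Empty p → ∣ p ∣ ≡ 0
Empty⇒∣p∣≡0 {n} empty = trans (cong ∣_∣ (Empty-unique empty)) (∣⊥∣≡0 n)

∣p∣≡0⇒Empty : ∣ p ∣ ≡ 0 → Empty p
∣p∣≡0⇒Empty ∣p∣≡0 (x , x∈p) =
  contradiction (subst₂ _≤_ (∣⁅x⁆∣≡1 x) ∣p∣≡0 (p⊆q⇒∣p∣≤∣q∣ (x∈p⇒⁅x⁆⊆p x∈p))) λ ()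

p⊆q∧∣q∣≤∣p∣⇒p≡q : p ⊆ q → ∣ q ∣ ≤ ∣ p ∣ → p ≡ q
p⊆q∧∣q∣≤∣p∣⇒p≡q {p = []} {[]} _ _ = refl
p⊆q∧∣q∣≤∣p∣⇒p≡q {p = inside ∷ p} {inside ∷ q} p⊆q (s≤s ∣q∣≤∣p∣) =
  cong (inside ∷_) (p⊆q∧∣q∣≤∣p∣⇒p≡q (drop-∷-⊆ p⊆q) ∣q∣≤∣p∣)
p⊆q∧∣q∣≤∣p∣⇒p≡q {p = outside ∷ p} {outside ∷ q} p⊆q ∣q∣≤∣p∣ =
  cong (outside ∷_) (p⊆q∧∣q∣≤∣p∣⇒p≡q (drop-∷-⊆ p⊆q) ∣q∣≤∣p∣)
p⊆q∧∣q∣≤∣p∣⇒p≡q {p = inside ∷ p} {outside ∷ q} p⊆q _ = contradiction (p⊆q here) λ ()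
p⊆q∧∣q∣≤∣p∣⇒p≡q {p = outside ∷ p} {inside ∷ q} p⊆q ∣q∣<∣p∣ =
  contradiction (p⊆q⇒∣p∣≤∣q∣ (drop-∷-⊆ p⊆q)) (<⇒≱ ∣q∣<∣p∣)

∣p∪q∣+∣p∩q∣≡∣p∣+∣q∣ : ∀ (p q : Subset n) → ∣ p ∪ q ∣ + ∣ p ∩ q ∣ ≡ ∣ p ∣ + ∣ q ∣
∣p∪q∣+∣p∩q∣≡∣p∣+∣q∣ [] [] = refl
∣p∪q∣+∣p∩q∣≡∣p∣+∣q∣ (inside ∷ p) (inside ∷ q) =
  cong suc (trans (+-suc _ _) (trans (cong suc (∣p∪q∣+∣p∩q∣≡∣p∣+∣q∣ p q)) (sym (+-suc _ _))))
∣p∪q∣+∣p∩q∣≡∣p∣+∣q∣ (inside ∷ p) (outside ∷ q) = cong suc (∣p∪q∣+∣p∩q∣≡∣p∣+∣q∣ p q)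
∣p∪q∣+∣p∩q∣≡∣p∣+∣q∣ (outside ∷ p) (inside ∷ q) =
  trans (cong suc (∣p∪q∣+∣p∩q∣≡∣p∣+∣q∣ p q)) (sym (+-suc _ _))
∣p∪q∣+∣p∩q∣≡∣p∣+∣q∣ (outside ∷ p) (outside ∷ q) = ∣p∪q∣+∣p∩q∣≡∣p∣+∣q∣ p q

∣p∪q∣≤∣p∣+∣q∣ : ∀ (p q : Subset n) → ∣ p ∪ q ∣ ≤ ∣ p ∣ + ∣ q ∣
∣p∪q∣≤∣p∣+∣q∣ p q = subst (∣ p ∪ q ∣ ≤_) (∣p∪q∣+∣p∩q∣≡∣p∣+∣q∣ p q) (m≤m+n _ _)

∣p∪q∣≡∣p∣+∣q∣ : Empty (p ∩ q) → ∣ p ∪ q ∣ ≡ ∣ p ∣ + ∣ q ∣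
∣p∪q∣≡∣p∣+∣q∣ {p = p} {q = q} disjoint = begin
  ∣ p ∪ q ∣               ≡⟨ +-identityʳ _ ⟨
  ∣ p ∪ q ∣ + 0           ≡⟨ cong (∣ p ∪ q ∣ +_) (Empty⇒∣p∣≡0 disjoint) ⟨
  ∣ p ∪ q ∣ + ∣ p ∩ q ∣   ≡⟨ ∣p∪q∣+∣p∩q∣≡∣p∣+∣q∣ p q ⟩
  ∣ p ∣ + ∣ q ∣           ∎
  where open ≡-Reasoning

∣p∩⁅x⁆∣≡1 : x ∈ p → ∣ p ∩ ⁅ x ⁆ ∣ ≡ 1
∣p∩⁅x⁆∣≡1 {x = x} {p = p} x∈p =
  trans (cong ∣_∣ (⊆-antisym (p∩q⊆q p ⁅ x ⁆) ⁅x⁆⊆p∩⁅x⁆)) (∣⁅x⁆∣≡1 x)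
  where
  ⁅x⁆⊆p∩⁅x⁆ : ⁅ x ⁆ ⊆ p ∩ ⁅ x ⁆
  ⁅x⁆⊆p∩⁅x⁆ y∈⁅x⁆ = x∈p∩q⁺ (x∈p⇒⁅x⁆⊆p x∈p y∈⁅x⁆ , y∈⁅x⁆)

∣p∩⁅x⁆∣≡0 : x ∉ p → ∣ p ∩ ⁅ x ⁆ ∣ ≡ 0
∣p∩⁅x⁆∣≡0 {x = x} {p = p} x∉p = Empty⇒∣p∣≡0 λ (y , y∈p∩⁅x⁆) →
  let y∈p , y∈⁅x⁆ = x∈p∩q⁻ p ⁅ x ⁆ y∈p∩⁅x⁆ in x∉p (subst (_∈ p) (x∈⁅y⁆⇒x≡y x y∈⁅x⁆) y∈p)

∉⁅x⁆∪⁅y⁆ : z ≢ x → z ≢ y → z ∉ ⁅ x ⁆ ∪ ⁅ y ⁆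
∉⁅x⁆∪⁅y⁆ {x = x} {y = y} z≢x z≢y z∈ =
  [ z≢x ∘ x∈⁅y⁆⇒x≡y x , z≢y ∘ x∈⁅y⁆⇒x≡y y ]′ (x∈p∪q⁻ ⁅ x ⁆ ⁅ y ⁆ z∈)

∣p∩⁅x⁆∪⁅y⁆∣ : x ≢ y → ∀ p → ∣ p ∩ (⁅ x ⁆ ∪ ⁅ y ⁆) ∣ ≡ ∣ p ∩ ⁅ x ⁆ ∣ + ∣ p ∩ ⁅ y ⁆ ∣
∣p∩⁅x⁆∪⁅y⁆∣ {x = x} {y = y} x≢y p =
  trans (cong ∣_∣ (∩-distribˡ-∪ p ⁅ x ⁆ ⁅ y ⁆)) (∣p∪q∣≡∣p∣+∣q∣ disjoint)
  where
  disjoint : Empty ((p ∩ ⁅ x ⁆) ∩ (p ∩ ⁅ y ⁆))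
  disjoint (z , z∈) =
    let z∈p∩⁅x⁆ , z∈p∩⁅y⁆ = x∈p∩q⁻ _ _ z∈
    in x≢y (trans (sym (x∈⁅y⁆⇒x≡y x (p∩q⊆q p _ z∈p∩⁅x⁆))) (x∈⁅y⁆⇒x≡y y (p∩q⊆q p _ z∈p∩⁅y⁆)))

∣⁅x⁆∪⁅y⁆∩p∣ : x ≢ y → ∀ p → ∣ (⁅ x ⁆ ∪ ⁅ y ⁆) ∩ p ∣ ≡ ∣ p ∩ ⁅ x ⁆ ∣ + ∣ p ∩ ⁅ y ⁆ ∣
∣⁅x⁆∪⁅y⁆∩p∣ x≢y p = trans (cong ∣_∣ (∩-comm _ p)) (∣p∩⁅x⁆∪⁅y⁆∣ x≢y p)

∣⁅x⁆∪⁅y⁆∣≡2 : x ≢ y → ∣ ⁅ x ⁆ ∪ ⁅ y ⁆ ∣ ≡ 2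
∣⁅x⁆∪⁅y⁆∣≡2 {n} {x} {y} x≢y = begin
  ∣ ⁅ x ⁆ ∪ ⁅ y ⁆ ∣                 ≡⟨ cong ∣_∣ (∩-identityˡ (⁅ x ⁆ ∪ ⁅ y ⁆)) ⟨
  ∣ ⊤ ∩ (⁅ x ⁆ ∪ ⁅ y ⁆) ∣           ≡⟨ ∣p∩⁅x⁆∪⁅y⁆∣ x≢y (⊤ {n}) ⟩
  ∣ ⊤ ∩ ⁅ x ⁆ ∣ + ∣ ⊤ ∩ ⁅ y ⁆ ∣     ≡⟨ cong₂ _+_ (∣p∩⁅x⁆∣≡1 (∈⊤ {x = x})) (∣p∩⁅x⁆∣≡1 (∈⊤ {x = y})) ⟩
  2                                 ∎
  where open ≡-Reasoning

∈∁[p∪q]⇒∉ : z ∈ ∁ (p ∪ q) → z ∉ p × z ∉ q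
∈∁[p∪q]⇒∉ z∈ = x∈∁p⇒x∉p z∈ ∘ x∈p∪q⁺ ∘ inj₁ , x∈∁p⇒x∉p z∈ ∘ x∈p∪q⁺ ∘ inj₂

shared : JVertex n k → JVertex n k → ℕ
shared u v = ∣ proj₁ u ∩ proj₁ v ∣

vertex-≡ : {u v : JVertex n k} → proj₁ u ≡ proj₁ v → u ≡ v
vertex-≡ {u = A , ∣A∣≡k} {v = .A , ∣A∣≡k′} refl = cong (A ,_) (≡-irrelevant ∣A∣≡k ∣A∣≡k′)

χ : JVertex n k → Fin n → ℕ
χ u x = ∣ proj₁ u ∩ ⁅ x ⁆ ∣

vertex-Nonempty : (u : JVertex n (suc k)) → Nonempty (proj₁ u)
vertex-Nonempty (A , ∣A∣≡1+k) = ∣p∣>0⇒Nonempty A (subst (_> 0) (sym ∣A∣≡1+k) (s≤s z≤n))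

shared-self : (u : JVertex n k) → shared u u ≡ k
shared-self (A , ∣A∣≡k) = trans (cong ∣_∣ (∩-idem A)) ∣A∣≡k

shared≤k : (u v : JVertex n k) → shared u v ≤ k
shared≤k (A , ∣A∣≡k) (B , _) = subst (∣ A ∩ B ∣ ≤_) ∣A∣≡k (p⊆q⇒∣p∣≤∣q∣ (p∩q⊆p A B))

shared≡k⇒≡ : {u v : JVertex n k} → shared u v ≡ k → u ≡ v
shared≡k⇒≡ {u = A , ∣A∣≡k} {v = B , ∣B∣≡k} ∣A∩B∣≡k = vertex-≡ (trans (sym A∩B≡A) A∩B≡B)
  where
  A∩B≡A : A ∩ B ≡ A
  A∩B≡A = p⊆q∧∣q∣≤∣p∣⇒p≡q (p∩q⊆p A B) (≤-reflexive (trans ∣A∣≡k (sym ∣A∩B∣≡k)))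
  A∩B≡B : A ∩ B ≡ B
  A∩B≡B = p⊆q∧∣q∣≤∣p∣⇒p≡q (p∩q⊆q A B) (≤-reflexive (trans ∣B∣≡k (sym ∣A∩B∣≡k)))

JAdj-sym : {u v : JVertex n k} → JAdj n k u v → JAdj n k v u
JAdj-sym {u = A , _} {v = B , _} = trans (cong (suc ∘ ∣_∣) (∩-comm B A))

pair : (x y : Fin n) → x ≢ y → JVertex n 2
pair x y x≢y = ⁅ x ⁆ ∪ ⁅ y ⁆ , ∣⁅x⁆∪⁅y⁆∣≡2 x≢y

∈∧∈⇒≡pair : (u : JVertex n 2) → x ∈ proj₁ u → y ∈ proj₁ u → (x≢y : x ≢ y) → u ≡ pair x y x≢y
∈∧∈⇒≡pair u x∈u y∈u x≢y =
  shared≡k⇒≡ (trans (∣p∩⁅x⁆∪⁅y⁆∣ x≢y (proj₁ u)) (cong₂ _+_ (∣p∩⁅x⁆∣≡1 x∈u) (∣p∩⁅x⁆∣≡1 y∈u)))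

disjoint⇒common-neighbour : (u v : JVertex n 2) → Empty (proj₁ u ∩ proj₁ v) →
                            ∃[ w ] (JAdj n 2 w u × JAdj n 2 w v)
disjoint⇒common-neighbour u@(A , _) v@(B , _) disjoint
  with a , a∈A ← vertex-Nonempty u | b , b∈B ← vertex-Nonempty v =
  pair a b a≢b ,
  cong suc (trans (∣⁅x⁆∪⁅y⁆∩p∣ a≢b A) (cong₂ _+_ (∣p∩⁅x⁆∣≡1 a∈A) (∣p∩⁅x⁆∣≡0 b∉A))) ,
  cong suc (trans (∣⁅x⁆∪⁅y⁆∩p∣ a≢b B) (cong₂ _+_ (∣p∩⁅x⁆∣≡0 a∉B) (∣p∩⁅x⁆∣≡1 b∈B)))
  where
  a∉B : a ∉ B
  a∉B a∈B = disjoint (a , x∈p∩q⁺ (a∈A , a∈B))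
  b∉A : b ∉ A
  b∉A b∈A = disjoint (b , x∈p∩q⁺ (b∈A , b∈B))
  a≢b : a ≢ b
  a≢b refl = a∉B b∈B

distance : JVertex n 2 → JVertex n 2 → ℕ
distance u v = 2 ∸ shared u v

walk : (u v : JVertex n 2) → Walk (JAdj n 2) u v (distance u v)
walk u v with shared u v in shared≡
... | 0 with w , w~u , w~v ← disjoint⇒common-neighbour u v (∣p∣≡0⇒Empty shared≡) =
  step {w = w} (JAdj-sym {u = w} {v = u} w~u) (step w~v here)
... | 1 = step (cong suc shared≡) here
... | 2 = subst (λ w → Walk _ u w 0) (shared≡k⇒≡ shared≡) here
... | suc (suc (suc _)) = contradiction (subst (_≤ 2) shared≡ (shared≤k u v)) λ { (s≤s (s≤s ())) }

distance-minimal : (u v : JVertex n 2) → ∀ m → Walk (JAdj n 2) u v m → distance u v ≤ m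
distance-minimal u .u 0 here = ≤-reflexive (cong (2 ∸_) (shared-self u))
distance-minimal u v 1 (step u~v here) = ≤-reflexive (cong (2 ∸_) (suc-injective u~v))
distance-minimal u v (suc (suc m)) _ = ≤-trans (m∸n≤m 2 (shared u v)) (s≤s (s≤s z≤n))

Dist-distance : (u v : JVertex n 2) → Dist (JAdj n 2) u v (distance u v)
Dist-distance u v = walk u v , distance-minimal u v

data AtMostOne : ℕ → ℕ → ℕ → Set where
  none  : AtMostOne 0 0 0
  only₀ : AtMostOne 1 0 0
  only₁ : AtMostOne 0 1 0
  only₂ : AtMostOne 0 0 1

equal-pair-sum : ∀ {a₀ a₁ a₂ b₀ b₁ b₂} → AtMostOne a₀ a₁ a₂ → AtMostOne b₀ b₁ b₂ →
                 a₁ + a₂ ≡ b₁ + b₂ ⊎ a₀ + a₂ ≡ b₀ + b₂ ⊎ a₀ + a₁ ≡ b₀ + b₁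
equal-pair-sum none  none  = inj₁ refl
equal-pair-sum none  only₀ = inj₁ refl
equal-pair-sum none  only₁ = inj₂ (inj₁ refl)
equal-pair-sum none  only₂ = inj₂ (inj₂ refl)
equal-pair-sum only₀ none  = inj₁ refl
equal-pair-sum only₀ only₀ = inj₁ refl
equal-pair-sum only₀ only₁ = inj₂ (inj₂ refl)
equal-pair-sum only₀ only₂ = inj₂ (inj₁ refl)
equal-pair-sum only₁ none  = inj₂ (inj₁ refl)
equal-pair-sum only₁ only₀ = inj₂ (inj₂ refl)
equal-pair-sum only₁ only₁ = inj₁ refl
equal-pair-sum only₁ only₂ = inj₁ refl
equal-pair-sum only₂ none  = inj₂ (inj₂ refl)
equal-pair-sum only₂ only₀ = inj₂ (inj₁ refl)
equal-pair-sum only₂ only₁ = inj₁ refl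
equal-pair-sum only₂ only₂ = inj₁ refl

module Triangle {n} {c₀ c₁ c₂ : Fin n} (c₀≢c₁ : c₀ ≢ c₁) (c₀≢c₂ : c₀ ≢ c₂) (c₁≢c₂ : c₁ ≢ c₂) where

  sides : List (JVertex n 2)
  sides = pair c₁ c₂ c₁≢c₂ ∷ pair c₀ c₂ c₀≢c₂ ∷ pair c₀ c₁ c₀≢c₁ ∷ []

  sides-unique : Unique sides
  sides-unique = (separated c₀∉s₀ c₀∈s₁ ∷ separated c₀∉s₀ c₀∈s₂ ∷ [])
               ∷ (separated c₁∉s₁ c₁∈s₂ ∷ [])
               ∷ []
               ∷ []
    where
    separated : {u v : JVertex n 2} → z ∉ proj₁ u → z ∈ proj₁ v → u ≢ v
    separated z∉u z∈v refl = z∉u z∈v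
    c₀∉s₀ : c₀ ∉ ⁅ c₁ ⁆ ∪ ⁅ c₂ ⁆
    c₀∉s₀ = ∉⁅x⁆∪⁅y⁆ c₀≢c₁ c₀≢c₂
    c₁∉s₁ : c₁ ∉ ⁅ c₀ ⁆ ∪ ⁅ c₂ ⁆
    c₁∉s₁ = ∉⁅x⁆∪⁅y⁆ (c₀≢c₁ ∘ sym) c₁≢c₂
    c₀∈s₁ : c₀ ∈ ⁅ c₀ ⁆ ∪ ⁅ c₂ ⁆
    c₀∈s₁ = x∈p∪q⁺ (inj₁ (x∈⁅x⁆ c₀))
    c₀∈s₂ : c₀ ∈ ⁅ c₀ ⁆ ∪ ⁅ c₁ ⁆
    c₀∈s₂ = x∈p∪q⁺ (inj₁ (x∈⁅x⁆ c₀))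
    c₁∈s₂ : c₁ ∈ ⁅ c₀ ⁆ ∪ ⁅ c₁ ⁆
    c₁∈s₂ = x∈p∪q⁺ (inj₂ (x∈⁅x⁆ c₁))

  corners-met : (u : JVertex n 2) → u ∉ᴸ sides → AtMostOne (χ u c₀) (χ u c₁) (χ u c₂)
  corners-met u u∉sides with c₀ ∈? proj₁ u | c₁ ∈? proj₁ u | c₂ ∈? proj₁ u
  ... | _ | yes c₁∈u | yes c₂∈u = contradiction (here (∈∧∈⇒≡pair u c₁∈u c₂∈u c₁≢c₂)) u∉sides
  ... | yes c₀∈u | _ | yes c₂∈u =
    contradiction (there (here (∈∧∈⇒≡pair u c₀∈u c₂∈u c₀≢c₂))) u∉sides
  ... | yes c₀∈u | yes c₁∈u | _ =
    contradiction (there (there (here (∈∧∈⇒≡pair u c₀∈u c₁∈u c₀≢c₁)))) u∉sides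
  ... | no c₀∉u | no c₁∉u | no c₂∉u
    rewrite ∣p∩⁅x⁆∣≡0 c₀∉u | ∣p∩⁅x⁆∣≡0 c₁∉u | ∣p∩⁅x⁆∣≡0 c₂∉u = none
  ... | yes c₀∈u | no c₁∉u | no c₂∉u
    rewrite ∣p∩⁅x⁆∣≡1 c₀∈u | ∣p∩⁅x⁆∣≡0 c₁∉u | ∣p∩⁅x⁆∣≡0 c₂∉u = only₀
  ... | no c₀∉u | yes c₁∈u | no c₂∉u
    rewrite ∣p∩⁅x⁆∣≡0 c₀∉u | ∣p∩⁅x⁆∣≡1 c₁∈u | ∣p∩⁅x⁆∣≡0 c₂∉u = only₁
  ... | no c₀∉u | no c₁∉u | yes c₂∈u
    rewrite ∣p∩⁅x⁆∣≡0 c₀∉u | ∣p∩⁅x⁆∣≡0 c₁∉u | ∣p∩⁅x⁆∣≡1 c₂∈u = only₂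

  sides-equalize : IsDistanceEqualizer (JAdj n 2) sides
  sides-equalize = Equivalence.from (IsDistanceEqualizer⇔Isδ-Equalizer Dist-distance sides)
    λ u v u∉sides v∉sides _ →
      equalizing-side u v (equal-pair-sum (corners-met u u∉sides) (corners-met v v∉sides))
    where
    equal-on-pair : ∀ u v {x y} (x≢y : x ≢ y) →
                    χ u x + χ u y ≡ χ v x + χ v y →
                    distance u (pair x y x≢y) ≡ distance v (pair x y x≢y)
    equal-on-pair u v x≢y eq =
      cong (2 ∸_) (trans (∣p∩⁅x⁆∪⁅y⁆∣ x≢y (proj₁ u)) (trans eq (sym (∣p∩⁅x⁆∪⁅y⁆∣ x≢y (proj₁ v)))))
    equalizing-side : ∀ u v →
      χ u c₁ + χ u c₂ ≡ χ v c₁ + χ v c₂ ⊎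
      χ u c₀ + χ u c₂ ≡ χ v c₀ + χ v c₂ ⊎
      χ u c₀ + χ u c₁ ≡ χ v c₀ + χ v c₁ →
      ∃[ x ] (x ∈ᴸ sides × distance u x ≡ distance v x)
    equalizing-side u v (inj₁ eq) = _ , here refl , equal-on-pair u v c₁≢c₂ eq
    equalizing-side u v (inj₂ (inj₁ eq)) = _ , there (here refl) , equal-on-pair u v c₀≢c₂ eq
    equalizing-side u v (inj₂ (inj₂ eq)) =
      _ , there (there (here refl)) , equal-on-pair u v c₀≢c₁ eq

n∸4≤∣∁[x∪y]∣ : (x y : JVertex n 2) → n ∸ 4 ≤ ∣ ∁ (proj₁ x ∪ proj₁ y) ∣
n∸4≤∣∁[x∪y]∣ {n} (X , ∣X∣≡2) (Y , ∣Y∣≡2) =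
  subst (n ∸ 4 ≤_) (sym (∣∁p∣≡n∸∣p∣ (X ∪ Y)))
        (∸-monoʳ-≤ n (subst (∣ X ∪ Y ∣ ≤_) (cong₂ _+_ ∣X∣≡2 ∣Y∣≡2) (∣p∪q∣≤∣p∣+∣q∣ X Y)))

disjoint-vertex : n ≥ 6 → (x y : JVertex n 2) → ∃[ u ] (shared u x ≡ 0 × shared u y ≡ 0)
disjoint-vertex n≥6 x@(X , _) y@(Y , _)
  with e , f , e≢f , e∈ , f∈ ←
         two-elements (∁ (X ∪ Y)) (≤-trans (∸-monoˡ-≤ 4 n≥6) (n∸4≤∣∁[x∪y]∣ x y))
  with e∉X , e∉Y ← ∈∁[p∪q]⇒∉ e∈ | f∉X , f∉Y ← ∈∁[p∪q]⇒∉ f∈ =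
  pair e f e≢f ,
  trans (∣⁅x⁆∪⁅y⁆∩p∣ e≢f X) (cong₂ _+_ (∣p∩⁅x⁆∣≡0 e∉X) (∣p∩⁅x⁆∣≡0 f∉X)) ,
  trans (∣⁅x⁆∪⁅y⁆∩p∣ e≢f Y) (cong₂ _+_ (∣p∩⁅x⁆∣≡0 e∉Y) (∣p∩⁅x⁆∣≡0 f∉Y))

common-neighbour : n ≥ 5 → (x y : JVertex n 2) → ∃[ w ] (JAdj n 2 w x × JAdj n 2 w y)
common-neighbour n≥5 x@(X , _) y@(Y , _) with nonempty? (X ∩ Y)
... | no disjoint = disjoint⇒common-neighbour x y disjoint
... | yes (a , a∈X∩Y)
  with a∈X , a∈Y ← x∈p∩q⁻ X Y a∈X∩Y
  with e , e∈ ← ∣p∣>0⇒Nonempty _ (≤-trans (∸-monoˡ-≤ 4 n≥5) (n∸4≤∣∁[x∪y]∣ x y))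
  with e∉X , e∉Y ← ∈∁[p∪q]⇒∉ e∈ =
  pair a e a≢e ,
  cong suc (trans (∣⁅x⁆∪⁅y⁆∩p∣ a≢e X) (cong₂ _+_ (∣p∩⁅x⁆∣≡1 a∈X) (∣p∩⁅x⁆∣≡0 e∉X))) ,
  cong suc (trans (∣⁅x⁆∪⁅y⁆∩p∣ a≢e Y) (cong₂ _+_ (∣p∩⁅x⁆∣≡1 a∈Y) (∣p∩⁅x⁆∣≡0 e∉Y)))
  where
  a≢e : a ≢ e
  a≢e refl = e∉X a∈X

no-equalizer-of-two : n ≥ 6 → (x y : JVertex n 2) → ¬ IsDistanceEqualizer (JAdj n 2) (x ∷ y ∷ [])
no-equalizer-of-two n≥6 x y
  with u , ux , uy ← disjoint-vertex n≥6 x y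
  with v , vx , vy ← common-neighbour (≤-trans (n≤1+n 5) n≥6) x y =
  far-near⇒¬equalizer Dist-distance u v (cong (2 ∸_) ux) (cong (2 ∸_) uy)
                          (cong (2 ∸_) (suc-injective vx)) (cong (2 ∸_) (suc-injective vy))

theorem3 : ∀ n → n ≥ 6 → EqDim≡ (JAdj n 2) 3
theorem3 _ n≥6@(s≤s (s≤s (s≤s _))) =
  (sides , sides-unique , sides-equalize , refl) ,
  λ S _ → equalizer-length≥3 (pair zero (suc zero) (λ ())) (no-equalizer-of-two n≥6)
  where open Triangle {c₀ = zero} {c₁ = suc zero} {c₂ = suc (suc zero)} (λ ()) (λ ()) (λ ())
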